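{- Let $G$ be an access graph, $I$ a request sequence respecting $G$, and $I_{\mathrm{LRU}}\in W(I,G,\mathrm{LRU})$. Write $I_{\mathrm{LRU}}$ as a concatenation $\langle I_1,I_2,I_3\rangle$ and let $I'=\langle I_1,I_2',I_3\rangle$, where $I_2'$ is any sequence (not necessarily of the same length as $I_2$) such that $I'$ respects $G$. Assume that (i) LRU incurs at least as many faults on $I_2'$ (when processing $I'$) as on $I_2$ (when processing $I_{\mathrm{LRU}}$); (ii) LRU's cache content, including the information about which pages are least recently used, is exactly the same just after $I_2'$ in $I'$ as just after $I_2$ in $I_{\mathrm{LRU}}$; (iii) $I_2'$ is obtained from $I_2$ by removing some requests and/or reordering requests; and (iv) the set of pages requested in $I$ equals the set of pages requested in $I'$. Then $I'\in W(I',G,\mathrm{LRU})$, and if $\mathrm{LRU}(I')\le \mathrm{FIFO}^G_W(I')$, then $\mathrm{LRU}^G_W(I)\le \mathrm{FIFO}^G_W(I)$.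
   Context: Paging: a cache of size $k\ge1$, initially empty; on a request to a page not in cache (a fault) the page is brought in, evicting a page if the cache is full; $\mathrm{A}(I)$ is the number of faults of algorithm $\mathrm{A}$ on $I$. LRU evicts the least recently requested page in cache; FIFO evicts the page that has been in cache the longest. An access graph is an undirected graph whose vertices are the pages; a sequence respects it if any two consecutive requests are to the same page or to adjacent vertices. For an algorithm $\mathrm{A}$ and access graph $G$, $\mathrm{A}^G_W(I)=\max_\sigma \mathrm{A}(\sigma(I))$ over all permutations $\sigma$ of the requests of $I$ such that $\sigma(I)$ respects $G$. $W(I,G,\mathrm{A})$ denotes the set of permutations $J$ of $I$ that respect $G$ and satisfy $\mathrm{A}(J)=\mathrm{A}^G_W(I)$ (worst orderings of $I$ for $\mathrm{A}$ on $G$). -}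

module Defs where

open import Data.Nat using (ℕ; zero; suc; _≤_; _≟_; _+_)
open import Data.Bool using (Bool; true; false; if_then_else_)
open import Data.List using (List; []; _∷_; take; _++_)
open import Data.List.Relation.Unary.Linked using (Linked)
open import Data.List.Relation.Binary.Permutation.Propositional using (_↭_)
open import Data.Product using (_×_; _,_; proj₁; proj₂; ∃)
open import Data.Sum using (_⊎_)
open import Relation.Binary.PropositionalEquality using (_≡_)
open import Relation.Nullary using (yes; no)
open import Level using (Level; _⊔_) renaming (suc to lsuc; zero to lzero)

Page : Set
Page = ℕ

record AccessGraph : Set₁ where
  field
    Adj : Page → Page → Set
    sym : ∀ {p q} → Adj p q → Adj q p
open AccessGraph public

Step : AccessGraph → Page → Page → Set
Step G p q = p ≡ q ⊎ Adj G p q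

Respects : AccessGraph → List Page → Set
Respects G I = Linked (Step G) I

elem : Page → List Page → Bool
elem p [] = false
elem p (q ∷ qs) with p ≟ q
... | yes _ = true
... | no _ = elem p qs

delete : Page → List Page → List Page
delete p [] = []
delete p (q ∷ qs) with p ≟ q
... | yes _ = qs
... | no _ = q ∷ delete p qs

-- A cache state is a list of pages. For LRU it is ordered from most
-- recently to least recently used; for FIFO from newest to oldest.
Cache : Set
Cache = List Page

-- One step: returns (number of faults (0 or 1), new cache).
-- On a fault with a full cache (k pages), take k drops the last page,
-- i.e. the least recently used (LRU) / the oldest (FIFO) one.
lruStep : ℕ → Cache → Page → ℕ × Cache
lruStep k c p = if elem p c then (0 , p ∷ delete p c) else (1 , take k (p ∷ c))

fifoStep : ℕ → Cache → Page → ℕ × Cache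
fifoStep k c p = if elem p c then (0 , c) else (1 , take k (p ∷ c))

run : (Cache → Page → ℕ × Cache) → Cache → List Page → ℕ × Cache
run step c [] = (0 , c)
run step c (p ∷ ps) =
  let r = step c p
      s = run step (proj₂ r) ps
  in (proj₁ r + proj₁ s , proj₂ s)

LRU : ℕ → List Page → ℕ
LRU k I = proj₁ (run (lruStep k) [] I)

FIFO : ℕ → List Page → ℕ
FIFO k I = proj₁ (run (fifoStep k) [] I)

Ordering : AccessGraph → List Page → List Page → Set
Ordering G I J = (J ↭ I) × Respects G J

IsWorstValue : AccessGraph → (List Page → ℕ) → List Page → ℕ → Set
IsWorstValue G A I m =
  (∃ λ J → Ordering G I J × A J ≡ m) × (∀ J → Ordering G I J → A J ≤ m)

InW : List Page → AccessGraph → (List Page → ℕ) → List Page → Set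
InW I G A J = Ordering G I J × (∀ J' → Ordering G I J' → A J' ≤ A J)

module Submission where

-- Since I₂' is a reordering of a subsequence S of I₂, the list I is a
-- permutation of R ++ I', where R (the requests of I₂ outside S) are all
-- pages that also occur in I' by hypothesis (iv).  Repeating a request
-- immediately costs nothing and changes nothing for LRU or FIFO (their
-- step functions are idempotent), and it preserves respecting G.  Hence
-- every G-respecting ordering J' of I' can be padded, by inserting each
-- request of R next to an occurrence of the same page, into a G-respecting
-- ordering J of I on which LRU and FIFO behave exactly as on J'.
-- Consequently any bound on LRU (or FIFO) over the orderings of I is also a
-- bound over the orderings of I'.  Together with LRU(I_LRU) ≤ LRU(I'),
-- which follows from (i) and (ii) by splitting the fault count, this shows
-- that I' is a worst ordering of itself and, using that FIFO^G_W(I') exists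
-- (classically, which suffices as the goal is a decidable inequality),
-- that LRU^G_W(I) ≤ LRU(I') ≤ FIFO^G_W(I') ≤ FIFO^G_W(I).

open import Defs
open import Data.Nat using (ℕ; _≤_)
open import Data.List using (List; _++_; [])
open import Data.List.Membership.Propositional using (_∈_)
open import Data.List.Relation.Binary.Permutation.Propositional using (_↭_)
open import Data.List.Relation.Binary.Sublist.Propositional using (_⊆_)
open import Data.Product using (_×_; ∃; proj₁; proj₂)
open import Function.Bundles using (_⇔_)
open import Relation.Binary.PropositionalEquality using (_≡_)

open import Data.Nat using (suc; zero; _+_; _≤?_; z≤n; s≤s; s≤s⁻¹)
open import Data.Nat.Properties
  using (≤-trans; ≤-antisym; +-assoc; +-monoʳ-≤; +-monoˡ-≤; n≤1+n; ≟-diag; ≰⇒>)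
open import Data.Bool using (true; false)
open import Data.List using (_∷_; length; take)
open import Data.List.Properties using (++-assoc)
open import Data.List.Relation.Unary.Any using (here; there)
open import Data.List.Relation.Unary.Linked using (_∷_)
open import Data.List.Relation.Binary.Sublist.Heterogeneous using ([]; _∷ʳ_; _∷_)
open import Data.List.Relation.Binary.Permutation.Propositional
  using (↭-refl; ↭-sym; ↭-trans; ↭-prep; module PermutationReasoning)
open import Data.List.Relation.Binary.Permutation.Propositional.Properties
  using (shift; shifts; zoom; ++⁺ˡ; ++-comm; ∈-resp-↭; ↭-length)
open import Data.List.Membership.Propositional.Properties using (∈-∃++; ∈-++⁺ˡ; ∈-++⁺ʳ)
open import Data.Product using (_,_)
open import Data.Sum using (inj₁)
open import Relation.Nullary using (¬_; yes; no)
open import Relation.Nullary.Decidable using (decidable-stable; ¬¬-excluded-middle)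
open import Relation.Binary.PropositionalEquality using (refl; cong; trans; subst)
  renaming (sym to ≡-sym)
open import Function.Bundles using (Equivalence)

StepFn : Set
StepFn = Cache → Page → ℕ × Cache

Faults : StepFn → List Page → ℕ
Faults step J = proj₁ (run step [] J)

Idempotent : StepFn → Set
Idempotent step = ∀ c p → step (proj₂ (step c p)) p ≡ (0 , proj₂ (step c p))

lruStep-front : ∀ k p d → lruStep k (p ∷ d) p ≡ (0 , p ∷ d)
lruStep-front k p d rewrite ≟-diag {p} {p} refl = refl

lruStep-idempotent : ∀ k → 1 ≤ k → Idempotent (lruStep k)
lruStep-idempotent (suc k) _ c p with elem p c
... | true  = lruStep-front (suc k) p (delete p c)
... | false = lruStep-front (suc k) p (take k c)

fifoStep-idempotent : ∀ k → 1 ≤ k → Idempotent (fifoStep k)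
fifoStep-idempotent (suc k) _ c p with elem p c in hit
... | true  rewrite hit = refl
... | false rewrite ≟-diag {p} {p} refl = refl

run-++-faults : ∀ step c xs ys →
  proj₁ (run step c (xs ++ ys))
    ≡ proj₁ (run step c xs) + proj₁ (run step (proj₂ (run step c xs)) ys)
run-++-faults step c [] ys = refl
run-++-faults step c (x ∷ xs) ys
  rewrite run-++-faults step (proj₂ (step c x)) xs ys =
  ≡-sym (+-assoc (proj₁ (step c x)) _ _)

replace-middle-faults : ∀ step c A B B' C →
  let cA = proj₂ (run step c A) in
  proj₁ (run step cA B) ≤ proj₁ (run step cA B') →
  proj₂ (run step cA B') ≡ proj₂ (run step cA B) →
  proj₁ (run step c (A ++ B ++ C)) ≤ proj₁ (run step c (A ++ B' ++ C))
replace-middle-faults step c A B B' C more same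
  rewrite run-++-faults step c A (B ++ C) | run-++-faults step c A (B' ++ C)
        | run-++-faults step (proj₂ (run step c A)) B C
        | run-++-faults step (proj₂ (run step c A)) B' C | same =
  +-monoʳ-≤ (proj₁ (run step c A)) (+-monoˡ-≤ _ more)

fifo-faults≤length : ∀ k c J → proj₁ (run (fifoStep k) c J) ≤ length J
fifo-faults≤length k c [] = z≤n
fifo-faults≤length k c (p ∷ J) with elem p c
... | true  = ≤-trans (fifo-faults≤length k c J) (n≤1+n _)
... | false = s≤s (fifo-faults≤length k _ J)

run-duplicate : ∀ step → Idempotent step → ∀ c xs p ys →
  run step c (xs ++ p ∷ p ∷ ys) ≡ run step c (xs ++ p ∷ ys)
run-duplicate step idem c [] p ys rewrite idem c p = refl
run-duplicate step idem c (x ∷ xs) p ys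
  rewrite run-duplicate step idem (proj₂ (step c x)) xs p ys = refl

respects-duplicate : ∀ G xs p ys →
  Respects G (xs ++ p ∷ ys) → Respects G (xs ++ p ∷ p ∷ ys)
respects-duplicate G [] p ys r = inj₁ refl ∷ r
respects-duplicate G (x ∷ []) p ys (s ∷ r) = s ∷ respects-duplicate G [] p ys r
respects-duplicate G (x ∷ y ∷ xs) p ys (s ∷ r) =
  s ∷ respects-duplicate G (y ∷ xs) p ys r

Indistinguishable : List Page → List Page → Set
Indistinguishable J J' = ∀ step → Idempotent step → ∀ c → run step c J ≡ run step c J'

pad : ∀ G R J' → (∀ {r} → r ∈ R → r ∈ J') →
  ∃ λ J → (J ↭ R ++ J') × (Respects G J' → Respects G J) × Indistinguishable J J'
pad G [] J' _ = J' , ↭-refl , (λ r → r) , λ _ _ _ → refl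
pad G (r ∷ R) J' occurs with pad G R J' (λ m → occurs (there m))
... | J , J↭ , resp , same
  with ∈-∃++ (∈-resp-↭ (↭-sym J↭) (∈-++⁺ʳ R (occurs (here refl))))
... | xs , ys , refl =
  xs ++ r ∷ r ∷ ys ,
  ↭-trans (shift r xs (r ∷ ys)) (↭-prep r J↭) ,
  (λ r' → respects-duplicate G xs r ys (resp r')) ,
  λ step idem c → trans (run-duplicate step idem c xs r ys) (same step idem c)

Embeds : AccessGraph → List Page → List Page → Set
Embeds G I' I = ∀ J' → Ordering G I' J' → ∃ λ J → Ordering G I J × Indistinguishable J J'

embeds : ∀ G R I I' → I ↭ R ++ I' → (∀ {r} → r ∈ R → r ∈ I') → Embeds G I' I
embeds G R I I' I↭ occurs J' (J'↭ , resp')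
  with pad G R J' (λ m → ∈-resp-↭ (↭-sym J'↭) (occurs m))
... | J , J↭ , resp , same =
  J , (↭-trans J↭ (↭-trans (++⁺ˡ R J'↭) (↭-sym I↭)) , resp resp') , same

bound-transfer : ∀ G I' I step → Idempotent step → Embeds G I' I →
  ∀ b → (∀ J → Ordering G I J → Faults step J ≤ b) →
  ∀ J' → Ordering G I' J' → Faults step J' ≤ b
bound-transfer G I' I step idem emb b bound J' o' with emb J' o'
... | J , o , same =
  subst (_≤ b) (cong proj₁ (same step idem [])) (bound J o)

sublist-complement : ∀ {X : Set} {S xs : List X} → S ⊆ xs → ∃ λ R → xs ↭ S ++ R
sublist-complement [] = [] , ↭-refl
sublist-complement {S = S} (y ∷ʳ sub) with sublist-complement sub
... | R , xs↭ = y ∷ R , ↭-trans (↭-prep y xs↭) (↭-sym (shift y S R))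
sublist-complement (refl ∷ sub) with sublist-complement sub
... | R , xs↭ = R , ↭-prep _ xs↭

replace-middle-↭ : ∀ {X : Set} {S R B' : List X} A B C → B ↭ S ++ R → B' ↭ S →
  A ++ B ++ C ↭ R ++ A ++ B' ++ C
replace-middle-↭ {S = S} {R} {B'} A B C B↭ B'↭ = begin
  A ++ B ++ C         ↭⟨ zoom A B↭ ⟩
  A ++ (S ++ R) ++ C  ↭⟨ zoom A (++-comm S R) ⟩
  A ++ (R ++ S) ++ C  ≡⟨ cong (A ++_) (++-assoc R S C) ⟩
  A ++ R ++ S ++ C    ↭⟨ shifts A R ⟩
  R ++ A ++ S ++ C    ↭⟨ ++⁺ˡ R (zoom A B'↭) ⟨
  R ++ A ++ B' ++ C   ∎
  where open PermutationReasoning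

worst-value-exists : ∀ G A I {J₀} → Ordering G I J₀ →
  ∀ t → (∀ J → Ordering G I J → A J ≤ t) → ¬ ¬ ∃ (IsWorstValue G A I)
worst-value-exists G A I {J₀} o₀ zero bound none =
  none (0 , (J₀ , o₀ , ≤-antisym (bound J₀ o₀) z≤n) , bound)
worst-value-exists G A I o₀ (suc t) bound none =
  ¬¬-excluded-middle {A = ∃ λ J → Ordering G I J × suc t ≤ A J} λ where
  (yes (J , o , reached)) →
    none (suc t , (J , o , ≤-antisym (bound J o) reached) , bound)
  (no unreached) →
    worst-value-exists G A I o₀ t
      (λ J o → s≤s⁻¹ (≰⇒> (λ reached → unreached (J , o , reached)))) none

lemma1 : (k : ℕ) → 1 ≤ k → (G : AccessGraph) → (I : List Page) → Respects G I →
    (I₁ I₂ I₃ I₂' : List Page) →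
    InW I G (LRU k) (I₁ ++ I₂ ++ I₃) →
    Respects G (I₁ ++ I₂' ++ I₃) →
    proj₁ (run (lruStep k) (proj₂ (run (lruStep k) [] I₁)) I₂)
      ≤ proj₁ (run (lruStep k) (proj₂ (run (lruStep k) [] I₁)) I₂') →
    proj₂ (run (lruStep k) (proj₂ (run (lruStep k) [] I₁)) I₂')
      ≡ proj₂ (run (lruStep k) (proj₂ (run (lruStep k) [] I₁)) I₂) →
    (∃ λ S → S ⊆ I₂ × I₂' ↭ S) →
    (∀ p → (p ∈ I) ⇔ (p ∈ (I₁ ++ I₂' ++ I₃))) →
    InW (I₁ ++ I₂' ++ I₃) G (LRU k) (I₁ ++ I₂' ++ I₃)
    × ((∀ n → IsWorstValue G (FIFO k) (I₁ ++ I₂' ++ I₃) n → LRU k (I₁ ++ I₂' ++ I₃) ≤ n) →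
       ∀ m n → IsWorstValue G (LRU k) I m → IsWorstValue G (FIFO k) I n → m ≤ n)
lemma1 k k≥1 G I _ I₁ I₂ I₃ I₂' ((I-LRU↭ , _) , LRU-worst) resp' more same
       (S , S⊆I₂ , I₂'↭S) samePages = I'-worst , lru≤fifo
  where
  I' = I₁ ++ I₂' ++ I₃
  R = proj₁ (sublist-complement S⊆I₂)
  I↭ : I ↭ R ++ I'
  I↭ = ↭-trans (↭-sym I-LRU↭)
         (replace-middle-↭ I₁ I₂ I₃ (proj₂ (sublist-complement S⊆I₂)) I₂'↭S)
  emb : Embeds G I' I
  emb = embeds G R I I' I↭ λ m →
          Equivalence.to (samePages _) (∈-resp-↭ (↭-sym I↭) (∈-++⁺ˡ m))
  LRU-I-LRU≤LRU-I' : LRU k (I₁ ++ I₂ ++ I₃) ≤ LRU k I'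
  LRU-I-LRU≤LRU-I' = replace-middle-faults (lruStep k) [] I₁ I₂ I₂' I₃ more same
  I'-worst : InW I' G (LRU k) I'
  I'-worst = (↭-refl , resp') ,
    bound-transfer G I' I (lruStep k) (lruStep-idempotent k k≥1) emb (LRU k I')
      (λ J o → ≤-trans (LRU-worst J o) LRU-I-LRU≤LRU-I')
  lru≤fifo : (∀ n → IsWorstValue G (FIFO k) I' n → LRU k I' ≤ n) →
    ∀ m n → IsWorstValue G (LRU k) I m → IsWorstValue G (FIFO k) I n → m ≤ n
  lru≤fifo hyp m n ((J , o , refl) , _) (_ , FIFO-bound) =
    ≤-trans (LRU-worst J o) (≤-trans LRU-I-LRU≤LRU-I' LRU-I'≤n)
    where
    FIFO-I'-bound : ∀ J' → Ordering G I' J' → FIFO k J' ≤ n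
    FIFO-I'-bound = bound-transfer G I' I (fifoStep k) (fifoStep-idempotent k k≥1) emb n FIFO-bound
    LRU-I'≤n : LRU k I' ≤ n
    LRU-I'≤n = decidable-stable (LRU k I' ≤? n) λ ¬≤ →
      worst-value-exists G (FIFO k) I' (↭-refl , resp') (length I')
        (λ J' (J'↭ , _) → subst (FIFO k J' ≤_) (↭-length J'↭) (fifo-faults≤length k [] J'))
        λ (n' , worst) → ¬≤ (≤-trans (hyp n' worst) (attained≤n worst))
      where
      attained≤n : ∀ {n'} → IsWorstValue G (FIFO k) I' n' → n' ≤ n
      attained≤n ((J' , o' , refl) , _) = FIFO-I'-bound J' o'
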